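{- Let $\lambda$ be a nonzero real number. For every integer $n\ge 0$, $$\mathrm{Bel}_{n,-\lambda}(1)=\sum_{j=0}^{n}\sum_{m=0}^{j}\binom{n}{j}(1)_{n-j,-\lambda}(-1)^{m}d_{m,\lambda}S_{2,-\lambda}(j,m).$$
   Context: For a nonzero real $\mu$ (used below with $\mu=\lambda$ and $\mu=-\lambda$), the degenerate falling factorial is $(x)_{0,\mu}=1$ and $(x)_{n,\mu}=x(x-\mu)\cdots(x-(n-1)\mu)$ for $n\ge1$; the degenerate exponential function is $e_{\mu}^{x}(t)=(1+\mu t)^{x/\mu}=\sum_{n\ge0}(x)_{n,\mu}\frac{t^n}{n!}$ and $e_\mu(t)=e_\mu^1(t)$. The degenerate derangement polynomials $d_{n,\lambda}(x)$ are defined by $\frac{1}{1-t}e_{\lambda}^{x-1}(t)=\sum_{n\ge0}d_{n,\lambda}(x)\frac{t^n}{n!}$, and $d_{n,\lambda}=d_{n,\lambda}(0)$. The fully degenerate Bell polynomials are defined by $e_{\mu}(x(e_{\mu}(t)-1))=\sum_{n\ge0}\mathrm{Bel}_{n,\mu}(x)\frac{t^n}{n!}$. The degenerate Stirling numbers of the second kind are defined by $\frac{1}{m!}(e_{\mu}(t)-1)^m=\sum_{n\ge m}S_{2,\mu}(n,m)\frac{t^n}{n!}$ for $m\ge0$. -}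

module Defs where

open import Level using (_⊔_)
open import Data.Nat using (ℕ; zero; suc; _∸_; _!)
open import Data.Nat.Combinatorics using (_C_)
open import Algebra.Bundles using (CommutativeRing)

ιR : ∀ {c ℓ} (R : CommutativeRing c ℓ) → ℕ → CommutativeRing.Carrier R
ιR R zero    = CommutativeRing.0# R
ιR R (suc n) = CommutativeRing._+_ R (CommutativeRing.1# R) (ιR R n)

-- A ℚ-algebra: a commutative ring in which every positive natural number
-- (1+n)·1 is invertible, with inverse  inv n .  ℝ is an instance.
record QAlgebra (c ℓ : Level.Level) : Set (Level.suc (c ⊔ ℓ)) where
  field
    cring     : CommutativeRing c ℓ
    inv       : ℕ → CommutativeRing.Carrier cring
    inv-right : ∀ n → CommutativeRing._≈_ cring
                  (CommutativeRing._*_ cring (ιR cring (suc n)) (inv n))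
                  (CommutativeRing.1# cring)
  open CommutativeRing cring public
  ι : ℕ → Carrier
  ι = ιR cring

module QAlgDefs {c ℓ} (Q : QAlgebra c ℓ) where
  open QAlgebra Q

  sumTo : ℕ → (ℕ → Carrier) → Carrier
  sumTo zero    f = f 0
  sumTo (suc n) f = sumTo n f + f (suc n)

  pow : Carrier → ℕ → Carrier
  pow x zero    = 1#
  pow x (suc n) = x * pow x n

  invFact : ℕ → Carrier
  invFact zero    = 1#
  invFact (suc m) = invFact m * inv m

  falling : Carrier → ℕ → Carrier → Carrier
  falling x zero    μ = 1#
  falling x (suc n) μ = falling x n μ * (x - ι n * μ)

  -- Exponential generating functions: F represents Σ_n F n t^n / n!
  EGF : Set c
  EGF = ℕ → Carrier

  _⊛_ : EGF → EGF → EGF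
  (F ⊛ G) n = sumTo n (λ k → ι (n C k) * (F k * G (n ∸ k)))

  oneE : EGF
  oneE zero    = 1#
  oneE (suc n) = 0#

  powE : EGF → ℕ → EGF
  powE F zero    = oneE
  powE F (suc m) = F ⊛ powE F m

  -- composition F(G(t)) for G with zero constant term:
  -- coefficient n is Σ_{k=0}^{n} F_k / k! · [t^n/n!] G(t)^k
  compE : EGF → EGF → EGF
  compE F G n = sumTo n (λ k → F k * (invFact k * powE G k n))

  -- degenerate exponential e_μ^x(t) = Σ (x)_{n,μ} t^n/n!
  eE : Carrier → Carrier → EGF
  eE μ x n = falling x n μ

  eMinus1 : Carrier → EGF
  eMinus1 μ zero    = 0#
  eMinus1 μ (suc n) = eE μ 1# (suc n)

  -- 1/(1-t) = Σ n! t^n/n!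
  geomE : EGF
  geomE n = ι (n !)

  -- degenerate derangement polynomials: 1/(1-t) e_λ^{x-1}(t)
  dPoly : Carrier → ℕ → Carrier → Carrier
  dPoly λ' n x = (geomE ⊛ eE λ' (x - 1#)) n

  dNum : Carrier → ℕ → Carrier
  dNum λ' n = dPoly λ' n 0#

  S2 : Carrier → ℕ → ℕ → Carrier
  S2 μ n m = invFact m * powE (eMinus1 μ) m n

  Bel : Carrier → ℕ → Carrier → Carrier
  Bel μ n x = compE (eE μ 1#) (λ k → x * eMinus1 μ k) n

-- With E = e_{-λ}(t) - 1, the left-hand side is Σ_k (1)_{k,-λ} E^k / k!, and the right-hand
-- side is the coefficient of t^n/n! in H(t) · e_{-λ}(t) for H = Σ_m (-1)^m d_{m,λ} E^m / m!.
-- Since e_{-λ}(t) = 1 + E, it suffices that the coefficients w_m of H in powers of E satisfy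
-- w_m + w_{m-1} = (1)_{m,-λ} / m!.  This follows from the derangement recurrence
-- d_{m+1,λ} = (-1)_{m+1,λ} + (m+1) d_{m,λ} (read off from the factor 1/(1-t)) together with
-- (-1)^k (-1)_{k,λ} = (1)_{k,-λ}.

module Submission where

open import Defs
open import Data.Nat using (ℕ; _∸_)
open import Data.Nat.Combinatorics using (_C_)
open import Relation.Nullary using (¬_)

module Binomial where
  open import Data.Nat
  open import Data.Nat.Properties
  open import Data.Nat.Combinatorics using (nCk≡n!/k![n-k]!; k![n∸k]!∣n!; k>n⇒nCk≡0)
  open import Data.Nat.DivMod using (m/n*n≡m)
  open import Relation.Binary.PropositionalEquality
  open import Relation.Nullary using (yes; no)
  open ≡-Reasoning

  nCk*k![n∸k]!≡n! : ∀ {n k} → k ≤ n → (n C k) * (k ! * (n ∸ k) !) ≡ n !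
  nCk*k![n∸k]!≡n! {n} {k} k≤n = begin
    (n C k) * (k ! * (n ∸ k) !)                 ≡⟨ cong (_* (k ! * (n ∸ k) !)) (nCk≡n!/k![n-k]! k≤n) ⟩
    n ! / (k ! * (n ∸ k) !) * (k ! * (n ∸ k) !) ≡⟨ m/n*n≡m (k![n∸k]!∣n! k≤n) ⟩
    n !                                       ∎
    where instance _ = k !* (n ∸ k) !≢0

  [1+n]C[1+k]*[1+k]!≡[1+n]*nCk*k! : ∀ n k → (suc n C suc k) * suc k ! ≡ suc n * ((n C k) * k !)
  [1+n]C[1+k]*[1+k]!≡[1+n]*nCk*k! n k with k ≤? n
  ... | yes k≤n = *-cancelʳ-≡ _ _ ((n ∸ k) !) {{(n ∸ k) !≢0}} (begin
    (suc n C suc k) * suc k ! * (n ∸ k) !     ≡⟨ *-assoc (suc n C suc k) (suc k !) ((n ∸ k) !) ⟩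
    (suc n C suc k) * (suc k ! * (n ∸ k) !)   ≡⟨ nCk*k![n∸k]!≡n! (s≤s k≤n) ⟩
    suc n * n !                             ≡⟨ cong (suc n *_) (nCk*k![n∸k]!≡n! k≤n) ⟨
    suc n * ((n C k) * (k ! * (n ∸ k) !))     ≡⟨ cong (suc n *_) (*-assoc (n C k) (k !) ((n ∸ k) !)) ⟨
    suc n * ((n C k) * k ! * (n ∸ k) !)       ≡⟨ *-assoc (suc n) ((n C k) * k !) ((n ∸ k) !) ⟨
    suc n * ((n C k) * k !) * (n ∸ k) !       ∎)
  ... | no k≰n = begin
    (suc n C suc k) * suc k !  ≡⟨ cong (_* suc k !) (k>n⇒nCk≡0 (s≤s (≰⇒> k≰n))) ⟩
    0                        ≡⟨ *-zeroʳ (suc n) ⟨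
    suc n * (0 * k !)        ≡⟨ cong (λ c → suc n * (c * k !)) (k>n⇒nCk≡0 (≰⇒> k≰n)) ⟨
    suc n * ((n C k) * k !)    ∎

open Binomial using ([1+n]C[1+k]*[1+k]!≡[1+n]*nCk*k!)

module PowerSeries {c ℓ} (Q : QAlgebra c ℓ) where
  open QAlgebra Q
  open QAlgDefs Q
  import Data.Nat as Nat
  open Nat using (zero; suc; _≤_; _<_; z≤n; s≤s; z<s; _!)
  open import Data.Nat.Properties
    using (≤-refl; m≤n⇒m≤1+n; m≤n⇒m<n∨m≡n; m∸n≤m; m∸[m∸n]≡n; ∸-monoʳ-<; <-≤-trans)
  open import Data.Nat.Combinatorics using (nCk≡nC[n∸k])
  open import Data.Sum using (inj₁; inj₂)
  import Relation.Binary.PropositionalEquality as ≡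
  open import Algebra.Properties.Ring ring using (-1*x≈-x; -‿distribˡ-*; -‿distribʳ-*; -‿involutive; -‿+-comm)
  open import Algebra.Properties.Semiring.Mult semiring using (_×_; ×1-homo-*)
  open import Algebra.Properties.CommutativeSemigroup *-commutativeSemigroup
    using (interchange; x∙yz≈y∙xz)
  open import Algebra.Properties.CommutativeSemigroup +-commutativeSemigroup
    using () renaming (interchange to +-interchange)
  open import Relation.Binary.Reasoning.Setoid setoid

  ≡⇒≈ : ∀ {x y} → x ≡.≡ y → x ≈ y
  ≡⇒≈ ≡.refl = refl

  ι-1 : ι 1 ≈ 1#
  ι-1 = +-identityʳ 1#

  ι≈×1# : ∀ n → ι n ≈ n × 1#
  ι≈×1# zero    = refl
  ι≈×1# (suc n) = +-congˡ (ι≈×1# n)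

  ι-homo-* : ∀ m n → ι (m Nat.* n) ≈ ι m * ι n
  ι-homo-* m n = begin
    ι (m Nat.* n)          ≈⟨ ι≈×1# (m Nat.* n) ⟩
    (m Nat.* n) × 1#       ≈⟨ ×1-homo-* m n ⟩
    (m × 1#) * (n × 1#)    ≈⟨ *-cong (ι≈×1# m) (ι≈×1# n) ⟨
    ι m * ι n              ∎

  sumTo-cong : ∀ n {f g} → (∀ k → k ≤ n → f k ≈ g k) → sumTo n f ≈ sumTo n g
  sumTo-cong zero    f≈g = f≈g 0 z≤n
  sumTo-cong (suc n) f≈g =
    +-cong (sumTo-cong n (λ k k≤n → f≈g k (m≤n⇒m≤1+n k≤n))) (f≈g (suc n) ≤-refl)

  sumTo-zero : ∀ n {f} → (∀ k → k ≤ n → f k ≈ 0#) → sumTo n f ≈ 0#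
  sumTo-zero zero    f≈0 = f≈0 0 z≤n
  sumTo-zero (suc n) f≈0 = trans
    (+-cong (sumTo-zero n (λ k k≤n → f≈0 k (m≤n⇒m≤1+n k≤n))) (f≈0 (suc n) ≤-refl))
    (+-identityˡ 0#)

  sumTo-+ : ∀ n f g → sumTo n (λ k → f k + g k) ≈ sumTo n f + sumTo n g
  sumTo-+ zero    f g = refl
  sumTo-+ (suc n) f g = trans (+-congʳ (sumTo-+ n f g)) (+-interchange _ _ _ _)

  *-distribˡ-sumTo : ∀ n x f → x * sumTo n f ≈ sumTo n (λ k → x * f k)
  *-distribˡ-sumTo zero    x f = refl
  *-distribˡ-sumTo (suc n) x f = trans (distribˡ x _ _) (+-congʳ (*-distribˡ-sumTo n x f))

  sumTo-suc : ∀ n f → sumTo (suc n) f ≈ f 0 + sumTo n (λ k → f (suc k))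
  sumTo-suc zero    f = refl
  sumTo-suc (suc n) f = trans (+-congʳ (sumTo-suc n f)) (+-assoc _ _ _)

  sumTo-reverse : ∀ n f → sumTo n f ≈ sumTo n (λ k → f (n ∸ k))
  sumTo-reverse zero    f = refl
  sumTo-reverse (suc n) f = begin
    sumTo n f + f (suc n)                  ≈⟨ +-congʳ (sumTo-reverse n f) ⟩
    sumTo n (λ k → f (n ∸ k)) + f (suc n)  ≈⟨ +-comm _ _ ⟩
    f (suc n) + sumTo n (λ k → f (n ∸ k))  ≈⟨ sumTo-suc n (λ k → f (suc n ∸ k)) ⟨
    sumTo (suc n) (λ k → f (suc n ∸ k))    ∎

  sumTo-extend : ∀ {n} m f → n ≤ m → (∀ k → n < k → k ≤ m → f k ≈ 0#) → sumTo n f ≈ sumTo m f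
  sumTo-extend zero    f z≤n  _   = refl
  sumTo-extend {n} (suc m) f n≤1+m f≈0 with m≤n⇒m<n∨m≡n n≤1+m
  ... | inj₂ ≡.refl    = refl
  ... | inj₁ (s≤s n≤m) = begin
    sumTo n f            ≈⟨ sumTo-extend m f n≤m (λ k n<k k≤m → f≈0 k n<k (m≤n⇒m≤1+n k≤m)) ⟩
    sumTo m f            ≈⟨ +-identityʳ _ ⟨
    sumTo m f + 0#       ≈⟨ +-congˡ (f≈0 (suc m) (s≤s n≤m) ≤-refl) ⟨
    sumTo (suc m) f      ∎

  sumTo-comm : ∀ n m (f : ℕ → ℕ → Carrier) →
    sumTo n (λ i → sumTo m (f i)) ≈ sumTo m (λ j → sumTo n (λ i → f i j))
  sumTo-comm zero    m f = refl
  sumTo-comm (suc n) m f = trans (+-congʳ (sumTo-comm n m f))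
    (sym (sumTo-+ m (λ j → sumTo n (λ i → f i j)) (f (suc n))))

  ⊛-comm : ∀ F G n → (F ⊛ G) n ≈ (G ⊛ F) n
  ⊛-comm F G n = trans (sumTo-reverse n _) (sumTo-cong n λ k k≤n →
    *-cong (≡⇒≈ (≡.cong ι (≡.sym (nCk≡nC[n∸k] k≤n))))
           (trans (*-comm _ _) (*-congʳ (≡⇒≈ (≡.cong G (m∸[m∸n]≡n k≤n))))))

  powE-cong : ∀ {F G} → (∀ i → F i ≈ G i) → ∀ m i → powE F m i ≈ powE G m i
  powE-cong F≈G zero    i = refl
  powE-cong F≈G (suc m) i = sumTo-cong i λ k _ → *-congˡ (*-cong (F≈G k) (powE-cong F≈G m (i ∸ k)))

  powE-vanish : ∀ {G} → G 0 ≈ 0# → ∀ m i → i < m → powE G m i ≈ 0#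
  powE-vanish G₀≈0 (suc m) i (s≤s i≤m) = sumTo-zero i λ where
    zero    _     → trans (*-congˡ (trans (*-congʳ G₀≈0) (zeroˡ _))) (zeroʳ _)
    (suc k) k<i → trans (*-congˡ (*-congˡ (powE-vanish G₀≈0 m (i ∸ suc k)
                          (<-≤-trans (∸-monoʳ-< z<s k<i) i≤m))))
                        (trans (*-congˡ (zeroʳ _)) (zeroʳ _))

  -- Σ_m w_m G^m; truncating at m = n is only correct when G has zero constant term.
  series : (ℕ → Carrier) → EGF → EGF
  series w G n = sumTo n (λ m → w m * powE G m n)

  series-cong : ∀ {v w} G n → (∀ m → v m ≈ w m) → series v G n ≈ series w G n
  series-cong G n v≈w = sumTo-cong n λ m _ → *-congʳ (v≈w m)

  ⊛-series : ∀ {G} → G 0 ≈ 0# → ∀ w n →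
    (G ⊛ series w G) n ≈ sumTo n (λ m → w m * powE G (suc m) n)
  ⊛-series {G} G₀≈0 w n = begin
    (G ⊛ series w G) n
      ≈⟨ sumTo-cong n (λ k _ → *-congˡ (*-congˡ (sumTo-extend n _ (m∸n≤m n k)
           (λ m n∸k<m _ → trans (*-congˡ (powE-vanish G₀≈0 m (n ∸ k) n∸k<m)) (zeroʳ _))))) ⟩
    sumTo n (λ k → ι (n C k) * (G k * sumTo n (λ m → w m * powE G m (n ∸ k))))
      ≈⟨ sumTo-cong n (λ k _ → pull-inside k) ⟩
    sumTo n (λ k → sumTo n (λ m → w m * (ι (n C k) * (G k * powE G m (n ∸ k)))))
      ≈⟨ sumTo-comm n n _ ⟩
    sumTo n (λ m → sumTo n (λ k → w m * (ι (n C k) * (G k * powE G m (n ∸ k)))))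
      ≈⟨ sumTo-cong n (λ m _ → sym (*-distribˡ-sumTo n (w m) _)) ⟩
    sumTo n (λ m → w m * powE G (suc m) n) ∎
    where
    pull-inside : ∀ k → ι (n C k) * (G k * sumTo n (λ m → w m * powE G m (n ∸ k)))
                      ≈ sumTo n (λ m → w m * (ι (n C k) * (G k * powE G m (n ∸ k))))
    pull-inside k = trans (*-congˡ (*-distribˡ-sumTo n _ _)) (trans (*-distribˡ-sumTo n _ _)
      (sumTo-cong n (λ m _ → trans (*-congˡ (x∙yz≈y∙xz _ _ _)) (x∙yz≈y∙xz _ _ _))))

  prev : (ℕ → Carrier) → ℕ → Carrier
  prev w zero    = 0#
  prev w (suc m) = w m

  series-*-1+ : ∀ {G} → G 0 ≈ 0# → ∀ w n →
    series w G n + (G ⊛ series w G) n ≈ series (λ m → w m + prev w m) G n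
  series-*-1+ {G} G₀≈0 w n = begin
    series w G n + (G ⊛ series w G) n
      ≈⟨ +-congˡ (⊛-series G₀≈0 w n) ⟩
    series w G n + sumTo n (λ m → w m * powE G (suc m) n)
      ≈⟨ +-congˡ shift ⟩
    series w G n + series (prev w) G n
      ≈⟨ sumTo-+ n _ _ ⟨
    sumTo n (λ m → w m * powE G m n + prev w m * powE G m n)
      ≈⟨ sumTo-cong n (λ m _ → distribʳ _ _ _) ⟨
    series (λ m → w m + prev w m) G n ∎
    where
    shift : sumTo n (λ m → w m * powE G (suc m) n) ≈ series (prev w) G n
    shift = sym (begin
      sumTo n (λ m → prev w m * powE G m n)
        ≈⟨ sumTo-extend (suc n) _ (m≤n⇒m≤1+n ≤-refl) (λ where
             (suc m) n<1+m _ → trans (*-congˡ (powE-vanish G₀≈0 (suc m) n n<1+m)) (zeroʳ _)) ⟩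
      sumTo (suc n) (λ m → prev w m * powE G m n)
        ≈⟨ sumTo-suc n _ ⟩
      0# * powE G 0 n + sumTo n (λ m → w m * powE G (suc m) n)
        ≈⟨ trans (+-congʳ (zeroˡ _)) (+-identityˡ _) ⟩
      sumTo n (λ m → w m * powE G (suc m) n) ∎)

  eE-⊛-eMinus1 : ∀ μ H n → (eE μ 1# ⊛ H) n ≈ H n + (eMinus1 μ ⊛ H) n
  eE-⊛-eMinus1 μ H zero = begin
    ι 1 * (1# * H 0)          ≈⟨ trans (*-cong ι-1 (*-identityˡ _)) (*-identityˡ _) ⟩
    H 0                       ≈⟨ +-identityʳ _ ⟨
    H 0 + 0#                  ≈⟨ +-congˡ (trans (*-congˡ (zeroˡ _)) (zeroʳ _)) ⟨
    H 0 + ι 1 * (0# * H 0)    ∎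
  eE-⊛-eMinus1 μ H (suc n) = begin
    (eE μ 1# ⊛ H) (suc n)               ≈⟨ sumTo-suc n _ ⟩
    ι 1 * (1# * H (suc n)) + T          ≈⟨ +-congʳ (trans (*-cong ι-1 (*-identityˡ _)) (*-identityˡ _)) ⟩
    H (suc n) + T                       ≈⟨ +-congˡ (+-identityˡ _) ⟨
    H (suc n) + (0# + T)                ≈⟨ +-congˡ (+-congʳ (trans (*-congˡ (zeroˡ _)) (zeroʳ _))) ⟨
    H (suc n) + (ι 1 * (0# * H (suc n)) + T) ≈⟨ +-congˡ (sumTo-suc n _) ⟨
    H (suc n) + (eMinus1 μ ⊛ H) (suc n) ∎
    where T = sumTo n (λ k → ι (suc n C suc k) * (eE μ 1# (suc k) * H (n ∸ k)))

  Bel-series : ∀ μ n → Bel μ n 1# ≈ series (λ k → falling 1# k μ * invFact k) (eMinus1 μ) n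
  Bel-series μ n = sumTo-cong n λ k _ → begin
    falling 1# k μ * (invFact k * powE (λ i → 1# * eMinus1 μ i) k n)
      ≈⟨ *-congˡ (*-congˡ (powE-cong (λ i → *-identityˡ _) k n)) ⟩
    falling 1# k μ * (invFact k * powE (eMinus1 μ) k n)
      ≈⟨ *-assoc _ _ _ ⟨
    falling 1# k μ * invFact k * powE (eMinus1 μ) k n ∎

  falling-congˡ : ∀ {x y} μ k → x ≈ y → falling x k μ ≈ falling y k μ
  falling-congˡ μ zero    x≈y = refl
  falling-congˡ μ (suc k) x≈y = *-cong (falling-congˡ μ k x≈y) (+-congʳ x≈y)

  negate-factor : ∀ x y z → - 1# * (- x - y * z) ≈ x - y * - z
  negate-factor x y z = begin
    - 1# * (- x - y * z)    ≈⟨ -1*x≈-x _ ⟩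
    - (- x - y * z)         ≈⟨ -‿cong (-‿+-comm x (y * z)) ⟩
    - - (x + y * z)         ≈⟨ -‿involutive _ ⟩
    x + y * z               ≈⟨ +-congˡ (trans (sym (-‿involutive _)) (-‿cong (-‿distribʳ-* y z))) ⟩
    x - y * - z             ∎

  falling-neg : ∀ x μ k → pow (- 1#) k * falling (- x) k μ ≈ falling x k (- μ)
  falling-neg x μ zero    = *-identityˡ 1#
  falling-neg x μ (suc k) = begin
    - 1# * pow (- 1#) k * (falling (- x) k μ * (- x - ι k * μ))
      ≈⟨ *-congʳ (*-comm _ _) ⟩
    pow (- 1#) k * - 1# * (falling (- x) k μ * (- x - ι k * μ))
      ≈⟨ interchange _ _ _ _ ⟩
    pow (- 1#) k * falling (- x) k μ * (- 1# * (- x - ι k * μ))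
      ≈⟨ *-cong (falling-neg x μ k) (negate-factor x (ι k) μ) ⟩
    falling x k (- μ) * (x - ι k * - μ) ∎

  invFact-suc : ∀ m → ι (suc m) * invFact (suc m) ≈ invFact m
  invFact-suc m = begin
    ι (suc m) * (invFact m * inv m)   ≈⟨ x∙yz≈y∙xz _ _ _ ⟩
    invFact m * (ι (suc m) * inv m)   ≈⟨ *-congˡ (inv-right m) ⟩
    invFact m * 1#                    ≈⟨ *-identityʳ _ ⟩
    invFact m                         ∎

  geomE-⊛-zero : ∀ G → (geomE ⊛ G) 0 ≈ G 0
  geomE-⊛-zero G = trans (*-cong ι-1 (trans (*-congʳ ι-1) (*-identityˡ _))) (*-identityˡ _)

  -- (1 - t) · (1/(1-t) · G) = G, read coefficientwise.
  geomE-⊛-suc : ∀ G m → (geomE ⊛ G) (suc m) ≈ G (suc m) + ι (suc m) * (geomE ⊛ G) m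
  geomE-⊛-suc G m = begin
    (geomE ⊛ G) (suc m)
      ≈⟨ sumTo-suc m _ ⟩
    ι 1 * (ι 1 * G (suc m)) + sumTo m (λ i → ι (suc m C suc i) * (ι (suc i !) * G (m ∸ i)))
      ≈⟨ +-cong (geomE-⊛-zero (λ i → G (suc m ∸ i))) (sumTo-cong m (λ i _ → absorb i)) ⟩
    G (suc m) + sumTo m (λ i → ι (suc m) * (ι (m C i) * (ι (i !) * G (m ∸ i))))
      ≈⟨ +-congˡ (*-distribˡ-sumTo m _ _) ⟨
    G (suc m) + ι (suc m) * (geomE ⊛ G) m ∎
    where
    absorb : ∀ i → ι (suc m C suc i) * (ι (suc i !) * G (m ∸ i))
                 ≈ ι (suc m) * (ι (m C i) * (ι (i !) * G (m ∸ i)))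
    absorb i = begin
      ι (suc m C suc i) * (ι (suc i !) * G (m ∸ i))
        ≈⟨ *-assoc _ _ _ ⟨
      ι (suc m C suc i) * ι (suc i !) * G (m ∸ i)
        ≈⟨ *-congʳ (ι-homo-* (suc m C suc i) (suc i !)) ⟨
      ι ((suc m C suc i) Nat.* suc i !) * G (m ∸ i)
        ≈⟨ *-congʳ (≡⇒≈ (≡.cong ι ([1+n]C[1+k]*[1+k]!≡[1+n]*nCk*k! m i))) ⟩
      ι (suc m Nat.* ((m C i) Nat.* i !)) * G (m ∸ i)
        ≈⟨ *-congʳ (trans (ι-homo-* (suc m) ((m C i) Nat.* i !)) (*-congˡ (ι-homo-* (m C i) (i !)))) ⟩
      ι (suc m) * (ι (m C i) * ι (i !)) * G (m ∸ i)
        ≈⟨ trans (*-assoc _ _ _) (*-congˡ (*-assoc _ _ _)) ⟩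
      ι (suc m) * (ι (m C i) * (ι (i !) * G (m ∸ i))) ∎

  module Derangement (λ' : Carrier) where

    dNum-zero : dNum λ' 0 ≈ 1#
    dNum-zero = geomE-⊛-zero (eE λ' (0# - 1#))

    dNum-suc : ∀ m → dNum λ' (suc m) ≈ falling (- 1#) (suc m) λ' + ι (suc m) * dNum λ' m
    dNum-suc m = trans (geomE-⊛-suc (eE λ' (0# - 1#)) m)
                       (+-congʳ (falling-congˡ λ' (suc m) (+-identityˡ (- 1#))))

    -- the coefficient of E^m in Σ_m (-1)^m d_{m,λ} S_{2,-λ}(·,m), as S_{2,μ}(·,m) is E^m/m!
    w : ℕ → Carrier
    w m = pow (- 1#) m * (dNum λ' m * invFact m)

    w-zero : w 0 ≈ 1#
    w-zero = trans (*-identityˡ _) (trans (*-identityʳ _) dNum-zero)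

    w-suc+w : ∀ m → w (suc m) + w m ≈ falling 1# (suc m) (- λ') * invFact (suc m)
    w-suc+w m = begin
      s′ * (dNum λ' (suc m) * F′) + w m
        ≈⟨ +-congʳ (*-congˡ (*-congʳ (dNum-suc m))) ⟩
      s′ * ((b′ + I * d) * F′) + w m
        ≈⟨ +-congʳ (trans (*-congˡ (distribʳ _ _ _)) (distribˡ _ _ _)) ⟩
      s′ * (b′ * F′) + s′ * (I * d * F′) + w m
        ≈⟨ +-assoc _ _ _ ⟩
      s′ * (b′ * F′) + (s′ * (I * d * F′) + w m)
        ≈⟨ +-cong (sym (*-assoc _ _ _)) cancel ⟩
      s′ * b′ * F′ + 0#
        ≈⟨ trans (+-identityʳ _) (*-congʳ (falling-neg 1# λ' (suc m))) ⟩
      falling 1# (suc m) (- λ') * F′ ∎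
      where
      s = pow (- 1#) m
      s′ = pow (- 1#) (suc m)
      d = dNum λ' m
      I = ι (suc m)
      F′ = invFact (suc m)
      b′ = falling (- 1#) (suc m) λ'
      cancel : s′ * (I * d * F′) + w m ≈ 0#
      cancel = begin
        s′ * (I * d * F′) + w m
          ≈⟨ +-congʳ (*-cong (-1*x≈-x s) (trans (*-congʳ (*-comm I d)) (*-assoc _ _ _))) ⟩
        - s * (d * (I * F′)) + w m
          ≈⟨ +-congʳ (*-congˡ (*-congˡ (invFact-suc m))) ⟩
        - s * (d * invFact m) + w m
          ≈⟨ +-congʳ (sym (-‿distribˡ-* _ _)) ⟩
        - w m + w m
          ≈⟨ -‿inverseˡ _ ⟩
        0# ∎

    w+prev-w : ∀ m → falling 1# m (- λ') * invFact m ≈ w m + prev w m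
    w+prev-w zero    = trans (*-identityˡ 1#) (sym (trans (+-identityʳ _) w-zero))
    w+prev-w (suc m) = sym (w-suc+w m)

    ⊛-eE-as-S2-sum : ∀ n →
      (series w (eMinus1 (- λ')) ⊛ eE (- λ') 1#) n ≈
        sumTo n (λ j → sumTo j (λ m →
          ι (n C j) * (falling 1# (n ∸ j) (- λ')
            * (pow (- 1#) m * (dNum λ' m * S2 (- λ') j m)))))
    ⊛-eE-as-S2-sum n = sumTo-cong n λ j _ → begin
      ι (n C j) * (series w E j * a (n ∸ j))
        ≈⟨ *-congˡ (trans (*-comm _ _) (*-distribˡ-sumTo j _ _)) ⟩
      ι (n C j) * sumTo j (λ m → a (n ∸ j) * (w m * powE E m j))
        ≈⟨ *-distribˡ-sumTo j _ _ ⟩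
      sumTo j (λ m → ι (n C j) * (a (n ∸ j) * (w m * powE E m j)))
        ≈⟨ sumTo-cong j (λ m _ → *-congˡ (*-congˡ (trans (*-assoc _ _ _) (*-congˡ (*-assoc _ _ _))))) ⟩
      sumTo j (λ m → ι (n C j) * (a (n ∸ j) * (pow (- 1#) m * (dNum λ' m * S2 (- λ') j m)))) ∎
      where
      E = eMinus1 (- λ')
      a = λ k → falling 1# k (- λ')

open PowerSeries

theorem10 : ∀ {c ℓ} (Q : QAlgebra c ℓ) →
    let open QAlgebra Q
        open QAlgDefs Q
    in ∀ (λ' : Carrier) → ¬ (λ' ≈ 0#) → ∀ (n : ℕ) →
      Bel (- λ') n 1# ≈
        sumTo n (λ j → sumTo j (λ m →
          ι (n C j) * (falling 1# (n ∸ j) (- λ')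
            * (pow (- 1#) m * (dNum λ' m * S2 (- λ') j m)))))
theorem10 Q λ' _ n = begin
  Bel μ n 1#                                       ≈⟨ Bel-series Q μ n ⟩
  series Q (λ k → falling 1# k μ * invFact k) E n  ≈⟨ series-cong Q E n w+prev-w ⟩
  series Q (λ m → w m + prev Q w m) E n            ≈⟨ series-*-1+ Q refl w n ⟨
  H n + (E ⊛ H) n                                  ≈⟨ eE-⊛-eMinus1 Q μ H n ⟨
  (eE μ 1# ⊛ H) n                                  ≈⟨ ⊛-comm Q _ H n ⟩
  (H ⊛ eE μ 1#) n                                  ≈⟨ ⊛-eE-as-S2-sum n ⟩
  _                                                ∎
  where
  open QAlgebra Q
  open QAlgDefs Q
  open Derangement Q λ'
  open import Relation.Binary.Reasoning.Setoid setoid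
  μ = - λ'
  E = eMinus1 μ
  H = series Q w E
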